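{- Let $n\ge1$, $i\in[n]$, $N\in[2^n]$ and $m=\min_{j\in[2^n]}\mathcal{S}(c_{i,n},j,N)$. Then for every integer $v$ with $m\le v\le N-m$ there exists $j\in[2^n]$ with $\mathcal{S}(c_{i,n},j,N)=v$.
   Context: For $m\ge0$ and $i\ge1$, $\mathrm{bin}(m,i)$ is the $i$-th bit of $m$ counted from the least significant bit. For $i\in[n]$, $c_{i,n}$ is the $0$-$1$ list of length $2^n$ with $c_{i,n}(j)=\mathrm{bin}(j-1,i)$. For a list $L$ of length $M$, $i\in[M]$ and $N\ge1$, $\mathcal{S}(L,i,N)=\sum_{j=0}^{N-1}L\big(1+((i+j-1)\bmod M)\big)$ is the cyclic contiguous sum of $N$ entries starting at index $i$. -}

module Defs where

open import Data.Nat using (ℕ; zero; suc; _+_; _∸_; _^_; _⊓_; NonZero)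
open import Data.Nat.DivMod using (_/_; _%_)
open import Data.Nat.Properties using (m^n≢0)
open import Data.List using (List; map; upTo)
open import Data.Nat.ListAction using (sum)

-- bin m i : the i-th bit of m counted from the least significant bit (i ≥ 1)
bin : ℕ → ℕ → ℕ
bin m i = (m / (2 ^ (i ∸ 1))) {{m^n≢0 2 (i ∸ 1)}} % 2

-- c i n : the 0-1 list of length 2^n, as a 1-indexed function: c i n j = bin (j-1) i
c : ℕ → ℕ → ℕ → ℕ
c i n j = bin (j ∸ 1) i

-- S L M i N : cyclic contiguous sum of N entries of the 1-indexed list L of length M,
-- starting at index i:  Σ_{j=0}^{N-1} L (1 + ((i + j - 1) mod M))
S : (ℕ → ℕ) → (M : ℕ) → .{{_ : NonZero M}} → ℕ → ℕ → ℕ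
S L M i N = sum (map (λ j → L (suc ((i + j ∸ 1) % M))) (upTo N))

-- minimum over j ∈ [K] = {1,…,K} of f j (K ≥ 1 in our uses)
minOver : ℕ → (ℕ → ℕ) → ℕ
minOver zero f = 0
minOver (suc zero) f = f 1
minOver (suc (suc k)) f = minOver (suc k) f ⊓ f (suc (suc k))

-- Index positions from 0 and write b x = bin x i for the i-th bit of x.  For every x the
-- sum S(c_{i,n}, x+1, N) is the window sum  W x = b x + b (x+1) + ⋯ + b (x+N-1),  because
-- the i-th bit of a number only depends on it modulo 2^n.  Two features of the sequence b
-- drive the argument:
--   * it is 0-1 valued, so moving a window one step to the right raises its sum by at most 1;
--   * shifting by p = 2^(i-1) complements it, hence  W (x + p) + W x = N  for every x.
-- So if the minimum m is attained by the window at position a, the window at a + p has sum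
-- N - m, and a discrete intermediate value theorem on the positions a, a+1, …, a+p meets
-- every value v with m ≤ v ≤ N - m; reducing the position modulo 2^n yields the index j.
module Submission where

open import Defs
open import Data.Nat using (ℕ; zero; suc; _+_; _*_; _∸_; _^_; _≤_; _<_; NonZero; z≤n; s≤s; _≤?_)
open import Data.Nat.Properties
open import Data.Nat.DivMod
open import Data.Nat.Divisibility using (_∣_; divides)
open import Data.Nat.ListAction using (sum)
open import Data.List using (map; applyUpTo)
open import Data.Product using (∃-syntax; _×_; _,_)
open import Data.Sum using (inj₁; inj₂)
open import Relation.Nullary using (yes; no)
open import Relation.Binary.PropositionalEquality
  using (_≡_; refl; sym; trans; cong; cong₂; subst; module ≡-Reasoning)
open import Function using (_∘_)
open import Algebra.Properties.CommutativeSemigroup +-commutativeSemigroup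
  using (interchange; xy∙z≈xz∙y)

sumBelow : ℕ → (ℕ → ℕ) → ℕ
sumBelow zero    f = 0
sumBelow (suc N) f = f 0 + sumBelow N (f ∘ suc)

sum-map-applyUpTo : ∀ (f g : ℕ → ℕ) N → sum (map f (applyUpTo g N)) ≡ sumBelow N (f ∘ g)
sum-map-applyUpTo f g zero    = refl
sum-map-applyUpTo f g (suc N) = cong (f (g 0) +_) (sum-map-applyUpTo f (g ∘ suc) N)

sumBelow-cong : ∀ {f g : ℕ → ℕ} N → (∀ t → f t ≡ g t) → sumBelow N f ≡ sumBelow N g
sumBelow-cong zero    f≡g = refl
sumBelow-cong (suc N) f≡g = cong₂ _+_ (f≡g 0) (sumBelow-cong N (f≡g ∘ suc))

sumBelow-last : ∀ (f : ℕ → ℕ) N → sumBelow (suc N) f ≡ sumBelow N f + f N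
sumBelow-last f zero    = +-comm (f 0) 0
sumBelow-last f (suc N) =
  trans (cong (f 0 +_) (sumBelow-last (f ∘ suc) N)) (sym (+-assoc (f 0) _ _))

sumBelow-+ : ∀ (f g : ℕ → ℕ) N →
  sumBelow N (λ t → f t + g t) ≡ sumBelow N f + sumBelow N g
sumBelow-+ f g zero    = refl
sumBelow-+ f g (suc N) =
  trans (cong (f 0 + g 0 +_) (sumBelow-+ (f ∘ suc) (g ∘ suc) N))
        (interchange (f 0) (g 0) (sumBelow N (f ∘ suc)) (sumBelow N (g ∘ suc)))

sumBelow-const : ∀ N k → sumBelow N (λ _ → k) ≡ N * k
sumBelow-const zero    k = refl
sumBelow-const (suc N) k = cong (k +_) (sumBelow-const N k)

ivt : (h : ℕ → ℕ) → (∀ k → h (suc k) ≤ suc (h k)) →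
  ∀ d v → h 0 ≤ v → v ≤ h d → ∃[ e ] (e ≤ d × h e ≡ v)
ivt h step zero    v h0≤v v≤hd = 0 , z≤n , ≤-antisym h0≤v v≤hd
ivt h step (suc d) v h0≤v v≤h[d+1] with v ≤? h d
... | yes v≤hd = let e , e≤d , he≡v = ivt h step d v h0≤v v≤hd in e , m≤n⇒m≤1+n e≤d , he≡v
... | no  v≰hd = suc d , ≤-refl , ≤-antisym (≤-trans (step d) (≰⇒> v≰hd)) v≤h[d+1]

window : (ℕ → ℕ) → ℕ → ℕ → ℕ
window f N x = sumBelow N (λ t → f (x + t))

window-slide : ∀ f N x → window f N x + f (x + N) ≡ f x + window f N (suc x)
window-slide f N x = begin
  window f N x + f (x + N)            ≡⟨ sumBelow-last (λ t → f (x + t)) N ⟨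
  sumBelow (suc N) (λ t → f (x + t))  ≡⟨ cong₂ _+_ (cong f (+-identityʳ x))
                                                   (sumBelow-cong N (cong f ∘ +-suc x)) ⟩
  f x + window f N (suc x)            ∎
  where open ≡-Reasoning

window-suc≤ : ∀ f N → (∀ y → f y ≤ 1) → ∀ x → window f N (suc x) ≤ suc (window f N x)
window-suc≤ f N f≤1 x = begin
  window f N (suc x)        ≤⟨ m≤n+m _ (f x) ⟩
  f x + window f N (suc x)  ≡⟨ window-slide f N x ⟨
  window f N x + f (x + N)  ≤⟨ +-monoʳ-≤ (window f N x) (f≤1 (x + N)) ⟩
  window f N x + 1          ≡⟨ +-comm (window f N x) 1 ⟩
  suc (window f N x)        ∎
  where open ≤-Reasoning

window-complement : ∀ f N p → (∀ y → f (y + p) + f y ≡ 1) →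
  ∀ x → window f N (x + p) + window f N x ≡ N
window-complement f N p flip x = begin
  window f N (x + p) + window f N x             ≡⟨ sumBelow-+ _ _ N ⟨
  sumBelow N (λ t → f (x + p + t) + f (x + t))  ≡⟨ sumBelow-cong N complement ⟩
  sumBelow N (λ _ → 1)                          ≡⟨ sumBelow-const N 1 ⟩
  N * 1                                         ≡⟨ *-identityʳ N ⟩
  N                                             ∎
  where
    open ≡-Reasoning
    complement : ∀ t → f (x + p + t) + f (x + t) ≡ 1
    complement t = trans (cong (λ y → f y + f (x + t)) (xy∙z≈xz∙y x p t)) (flip (x + t))

-- The core argument: for such a sequence, every v with W a ≤ v ≤ N - W a is the sum of
-- some window at a position between a and a + p, since the window at a + p has sum N - W a.
window-intermediate : ∀ f N p → (∀ y → f y ≤ 1) → (∀ y → f (y + p) + f y ≡ 1) →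
  ∀ a v → window f N a ≤ v → v + window f N a ≤ N →
  ∃[ e ] (e ≤ p × window f N (a + e) ≡ v)
window-intermediate f N p f≤1 flip a v Wa≤v v+Wa≤N =
  ivt (W ∘ (a +_)) step p v (subst (_≤ v) (cong W (sym (+-identityʳ a))) Wa≤v) v≤W[a+p]
  where
    W : ℕ → ℕ
    W = window f N
    step : ∀ k → W (a + suc k) ≤ suc (W (a + k))
    step k = ≤-trans (≤-reflexive (cong W (+-suc a k))) (window-suc≤ f N f≤1 (a + k))
    v≤W[a+p] : v ≤ W (a + p)
    v≤W[a+p] = +-cancelʳ-≤ (W a) v (W (a + p))
      (subst (v + W a ≤_) (sym (window-complement f N p flip a)) v+Wa≤N)

minOver-attained : ∀ K (f : ℕ → ℕ) → 1 ≤ K → ∃[ a ] (a < K × minOver K f ≡ f (suc a))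
minOver-attained (suc zero)    f _ = 0 , s≤s z≤n , refl
minOver-attained (suc (suc k)) f _ with minOver-attained (suc k) f (s≤s z≤n)
... | a , a<K , min≡fa with ⊓-sel (minOver (suc k) f) (f (suc (suc k)))
...   | inj₁ min≡left  = a , m≤n⇒m≤1+n a<K , trans min≡left min≡fa
...   | inj₂ min≡right = suc k , ≤-refl , min≡right

%2-suc-flip : ∀ q → suc q % 2 + q % 2 ≡ 1
%2-suc-flip zero          = refl
%2-suc-flip (suc zero)    = refl
%2-suc-flip (suc (suc q)) =
  trans (cong₂ _+_ ([2+m]%2≡m%2 (suc q)) ([2+m]%2≡m%2 q)) (%2-suc-flip q)
  where
    [2+m]%2≡m%2 : ∀ m → (2 + m) % 2 ≡ m % 2
    [2+m]%2≡m%2 m = trans (%-congˡ (+-comm 2 m)) ([m+n]%n≡m%n m 2)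

bin≤1 : ∀ m i → bin m i ≤ 1
bin≤1 m i = ≤-pred (m%n<n ((m / 2 ^ (i ∸ 1)) {{m^n≢0 2 (i ∸ 1)}}) 2)

bin-flip : ∀ i m → bin (m + 2 ^ (i ∸ 1)) i + bin m i ≡ 1
bin-flip i m = trans (cong (λ q → q % 2 + bin m i) [m+p]/p≡1+m/p) (%2-suc-flip (m / p))
  where
    p : ℕ
    p = 2 ^ (i ∸ 1)
    instance
      p≢0 : NonZero p
      p≢0 = m^n≢0 2 (i ∸ 1)
    [m+p]/p≡1+m/p : (m + p) / p ≡ suc (m / p)
    [m+p]/p≡1+m/p = trans (m/n≡1+[m∸n]/n (m≤n+m p m)) (cong (λ y → suc (y / p)) (m+n∸n≡m m p))

2^n-split : ∀ {j n} → j < n → 2 ^ n ≡ (2 * 2 ^ (n ∸ suc j)) * 2 ^ j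
2^n-split {j} {n} j<n = begin
  2 ^ n                        ≡⟨ cong (2 ^_) (m+[n∸m]≡n j<n) ⟨
  2 ^ (suc j + d)              ≡⟨ cong (2 ^_) (+-suc j d) ⟨
  2 ^ (j + suc d)              ≡⟨ ^-distribˡ-+-* 2 j (suc d) ⟩
  2 ^ j * 2 ^ suc d            ≡⟨ *-comm (2 ^ j) (2 ^ suc d) ⟩
  (2 * 2 ^ d) * 2 ^ j          ∎
  where
    open ≡-Reasoning
    d : ℕ
    d = n ∸ suc j

[m%d+n]%d≡[m+n]%d : ∀ m n d .{{_ : NonZero d}} → (m % d + n) % d ≡ (m + n) % d
[m%d+n]%d≡[m+n]%d m n d = begin
  (m % d + n) % d              ≡⟨ %-distribˡ-+ (m % d) n d ⟩
  (m % d % d + n % d) % d      ≡⟨ cong (λ y → (y + n % d) % d) (m%n%n≡m%n m d) ⟩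
  (m % d + n % d) % d          ≡⟨ %-distribˡ-+ m n d ⟨
  (m + n) % d                  ∎
  where open ≡-Reasoning

module Modulo2^ (n : ℕ) where

  instance
    2^n≢0 : NonZero (2 ^ n)
    2^n≢0 = m^n≢0 2 n

  bin-mod : ∀ m {i} → 1 ≤ i → i ≤ n → bin (m % 2 ^ n) i ≡ bin m i
  bin-mod m {suc j} _ j<n = begin
    (m % 2 ^ n) / 2 ^ j % 2        ≡⟨ cong (λ q → q / 2 ^ j % 2) (%-congʳ (2^n-split j<n)) ⟩
    (m % (Q * 2 ^ j)) / 2 ^ j % 2  ≡⟨ cong (_% 2) (m%[n*o]/o≡m/o%n m Q (2 ^ j)) ⟩
    m / 2 ^ j % Q % 2              ≡⟨ m∣n⇒o%n%m≡o%m 2 Q (m / 2 ^ j) 2∣Q ⟩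
    m / 2 ^ j % 2                  ∎
    where
      open ≡-Reasoning
      d Q : ℕ
      d = n ∸ suc j
      Q = 2 * 2 ^ d
      2∣Q : 2 ∣ Q
      2∣Q = divides (2 ^ d) (*-comm 2 (2 ^ d))
      instance
        2^j≢0 : NonZero (2 ^ j)
        2^j≢0 = m^n≢0 2 j
        Q≢0 : NonZero Q
        Q≢0 = m^n≢0 2 (suc d)
        Q*2^j≢0 : NonZero (Q * 2 ^ j)
        Q*2^j≢0 = m*n≢0 Q (2 ^ j)

  S-window : ∀ {i} N x → 1 ≤ i → i ≤ n →
    S (c i n) (2 ^ n) (suc (x % 2 ^ n)) N ≡ window (λ y → bin y i) N x
  S-window {i} N x 1≤i i≤n = trans (sum-map-applyUpTo _ (λ t → t) N) (sumBelow-cong N bit-at)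
    where
      bit-at : ∀ t → bin ((x % 2 ^ n + t) % 2 ^ n) i ≡ bin (x + t) i
      bit-at t = trans (cong (λ y → bin y i) ([m%d+n]%d≡[m+n]%d x t (2 ^ n)))
                       (bin-mod (x + t) 1≤i i≤n)

open Modulo2^ using (S-window)

lemma12 : (n i N : ℕ) → 1 ≤ n → 1 ≤ i → i ≤ n → 1 ≤ N → N ≤ 2 ^ n →
    (v : ℕ) → minOver (2 ^ n) (λ j → S (c i n) (2 ^ n) {{m^n≢0 2 n}} j N) ≤ v →
    v + minOver (2 ^ n) (λ j → S (c i n) (2 ^ n) {{m^n≢0 2 n}} j N) ≤ N →
    ∃[ j ] (1 ≤ j × j ≤ 2 ^ n × S (c i n) (2 ^ n) {{m^n≢0 2 n}} j N ≡ v)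
lemma12 n i N _ 1≤i i≤n _ _ v m≤v v+m≤N =
  let
      a , a<2^n , m≡S[a+1] = minOver-attained (2 ^ n) (λ j → S (c i n) (2 ^ n) j N) (m^n>0 2 n)
      m≡W[a] : minOver (2 ^ n) (λ j → S (c i n) (2 ^ n) j N) ≡ window bit N a
      m≡W[a] = trans m≡S[a+1] (trans (cong (λ x → S (c i n) (2 ^ n) (suc x) N)
                                             (sym (m<n⇒m%n≡m a<2^n)))
                                      (S-window n N a 1≤i i≤n))
      e , _ , W[a+e]≡v = window-intermediate bit N (2 ^ (i ∸ 1)) (λ y → bin≤1 y i) (bin-flip i)
                           a v (subst (_≤ v) m≡W[a] m≤v) (subst (λ m → v + m ≤ N) m≡W[a] v+m≤N)
  in suc ((a + e) % 2 ^ n) , s≤s z≤n , m%n<n (a + e) (2 ^ n) ,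
     trans (S-window n N (a + e) 1≤i i≤n) W[a+e]≡v
  where
    open Modulo2^ n using (2^n≢0)
    bit : ℕ → ℕ
    bit y = bin y i
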